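{- Let $A$ be a non-empty set of atoms. For all terms $s,t$ over the signature $\Sigma_{\mathrm{SCL}}(A)$ (possibly containing variables), if $\mathrm{EqFSCL}\vdash s=t$, then $\mathbb{M}_{se}\models s=t$.
   Context: The signature $\Sigma_{\mathrm{SCL}}(A)$ consists of constants $\mathsf T,\mathsf F$ and $a$ for each $a\in A$, a unary connective $\neg$, and two binary connectives $\wedge$ and $\vee$ (left-sequential, short-circuit conjunction and disjunction). $\mathcal S_A$ is the set of closed terms over this signature. $\mathrm{EqFSCL}\vdash s=t$ means that $s=t$ is derivable in equational logic (reflexivity, symmetry, transitivity, congruence, substitution) from the following axioms: (F1) $\mathsf F=\neg\mathsf T$; (F2) $x\vee y=\neg(\neg x\wedge\neg y)$; (F3) $\neg\neg x=x$; (F4) $\mathsf T\wedge x=x$; (F5) $x\vee\mathsf F=x$; (F6) $\mathsf F\wedge x=\mathsf F$; (F7) $(x\wedge y)\wedge z=x\wedge(y\wedge z)$; (F8) $\neg x\wedge\mathsf F=x\wedge\mathsf F$; (F9) $(x\wedge\mathsf F)\vee y=(x\vee\mathsf T)\wedge y$; (F10) $(x\wedge y)\vee(z\wedge\mathsf F)=(x\vee(z\wedge\mathsf F))\wedge(y\vee(z\wedge\mathsf F))$. Evaluation trees over $A$: the set $\mathcal T_A$ is the least set containing $\mathsf T$ and $\mathsf F$ and containing $X\trianglelefteq a\trianglerighteq Y$ (root $a$, left branch $X$, right branch $Y$) for all $X,Y\in\mathcal T_A$, $a\in A$. Leaf replacement $X[\mathsf T\mapsto Y,\mathsf F\mapsto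 Z]$ is defined by $\mathsf T[\mathsf T\mapsto Y,\mathsf F\mapsto Z]=Y$, $\mathsf F[\mathsf T\mapsto Y,\mathsf F\mapsto Z]=Z$, $(X_1\trianglelefteq a\trianglerighteq X_2)[\ldots]=X_1[\ldots]\trianglelefteq a\trianglerighteq X_2[\ldots]$; unlisted leaves are left unchanged. The short-circuit evaluation function $se:\mathcal S_A\to\mathcal T_A$ is given by $se(\mathsf T)=\mathsf T$, $se(\mathsf F)=\mathsf F$, $se(a)=\mathsf T\trianglelefteq a\trianglerighteq\mathsf F$, $se(\neg P)=se(P)[\mathsf T\mapsto\mathsf F,\mathsf F\mapsto\mathsf T]$, $se(P\wedge Q)=se(P)[\mathsf T\mapsto se(Q)]$, $se(P\vee Q)=se(P)[\mathsf F\mapsto se(Q)]$. The model $\mathbb M_{se}$ is the $\Sigma_{\mathrm{SCL}}(A)$-algebra with domain $\{se(P)\mid P\in\mathcal S_A\}$, constants interpreted as $\mathsf T$, $\mathsf F$, $\mathsf T\trianglelefteq a\trianglerighteq\mathsf F$, and $\neg X=X[\mathsf T\mapsto\mathsf F,\mathsf F\mapsto\mathsf T]$, $X\wedge Y=X[\mathsf T\mapsto Y]$, $X\vee Y=X[\mathsf F\mapsto Y]$. $\mathbb M_{se}\models s=t$ means that $s$ and $t$ have equal interpretation in $\mathbb M_{se}$ under every assignment of domain elements to variables. -}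

module Defs where

open import Data.Nat using (ℕ)
open import Data.Product using (Σ; _,_; proj₁)
open import Relation.Binary.PropositionalEquality using (_≡_)

data Term (A : Set) : Set where
  var  : ℕ → Term A
  T F  : Term A
  atom : A → Term A
  ¬'_  : Term A → Term A
  _∧'_ _∨'_ : Term A → Term A → Term A

infixr 6 _∧'_
infixr 5 _∨'_
infix 7 ¬'_

data Closed (A : Set) : Set where
  T F  : Closed A
  atom : A → Closed A
  ¬'_  : Closed A → Closed A
  _∧'_ _∨'_ : Closed A → Closed A → Closed A

subst : {A : Set} → (ℕ → Term A) → Term A → Term A
subst σ (var n)   = σ n
subst σ T         = T
subst σ F         = F
subst σ (atom a)  = atom a
subst σ (¬' x)    = ¬' subst σ x
subst σ (x ∧' y)  = subst σ x ∧' subst σ y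
subst σ (x ∨' y)  = subst σ x ∨' subst σ y

module _ {A : Set} where
  private
    x y z : Term A
    x = var 0
    y = var 1
    z = var 2

  data Axiom : Term A → Term A → Set where
    F1  : Axiom F (¬' T)
    F2  : Axiom (x ∨' y) (¬' ((¬' x) ∧' (¬' y)))
    F3  : Axiom (¬' (¬' x)) x
    F4  : Axiom (T ∧' x) x
    F5  : Axiom (x ∨' F) x
    F6  : Axiom (F ∧' x) F
    F7  : Axiom ((x ∧' y) ∧' z) (x ∧' (y ∧' z))
    F8  : Axiom ((¬' x) ∧' F) (x ∧' F)
    F9  : Axiom ((x ∧' F) ∨' y) ((x ∨' T) ∧' y)
    F10 : Axiom ((x ∧' y) ∨' (z ∧' F))
                ((x ∨' (z ∧' F)) ∧' (y ∨' (z ∧' F)))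

data EqFSCL⊢ {A : Set} : Term A → Term A → Set where
  ax    : ∀ {s t} → Axiom s t → EqFSCL⊢ s t
  refl' : ∀ {s} → EqFSCL⊢ s s
  sym'  : ∀ {s t} → EqFSCL⊢ s t → EqFSCL⊢ t s
  trans' : ∀ {s t u} → EqFSCL⊢ s t → EqFSCL⊢ t u → EqFSCL⊢ s u
  cong¬ : ∀ {s t} → EqFSCL⊢ s t → EqFSCL⊢ (¬' s) (¬' t)
  cong∧ : ∀ {s s' t t'} → EqFSCL⊢ s s' → EqFSCL⊢ t t' → EqFSCL⊢ (s ∧' t) (s' ∧' t')
  cong∨ : ∀ {s s' t t'} → EqFSCL⊢ s s' → EqFSCL⊢ t t' → EqFSCL⊢ (s ∨' t) (s' ∨' t')
  inst  : ∀ {s t} (σ : ℕ → Term A) → EqFSCL⊢ s t → EqFSCL⊢ (subst σ s) (subst σ t)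

data Tree (A : Set) : Set where
  T F : Tree A
  node : Tree A → A → Tree A → Tree A

-- Leaf replacement X[T ↦ Y, F ↦ Z]
replace : {A : Set} → Tree A → Tree A → Tree A → Tree A
replace T Y Z = Y
replace F Y Z = Z
replace (node X₁ a X₂) Y Z = node (replace X₁ Y Z) a (replace X₂ Y Z)

replaceT : {A : Set} → Tree A → Tree A → Tree A
replaceT X Y = replace X Y F

replaceF : {A : Set} → Tree A → Tree A → Tree A
replaceF X Y = replace X T Y

se : {A : Set} → Closed A → Tree A
se T = T
se F = F
se (atom a) = node T a F
se (¬' P) = replace (se P) F T
se (P ∧' Q) = replaceT (se P) (se Q)
se (P ∨' Q) = replaceF (se P) (se Q)

Dom : Set → Set
Dom A = Σ (Tree A) (λ X → Σ (Closed A) (λ P → se P ≡ X))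

⟦_⟧ : {A : Set} → Term A → (ℕ → Dom A) → Tree A
⟦ var n ⟧ ρ = proj₁ (ρ n)
⟦ T ⟧ ρ = T
⟦ F ⟧ ρ = F
⟦ atom a ⟧ ρ = node T a F
⟦ ¬' t ⟧ ρ = replace (⟦ t ⟧ ρ) F T
⟦ s ∧' t ⟧ ρ = replaceT (⟦ s ⟧ ρ) (⟦ t ⟧ ρ)
⟦ s ∨' t ⟧ ρ = replaceF (⟦ s ⟧ ρ) (⟦ t ⟧ ρ)

Mse⊨ : {A : Set} → Term A → Term A → Set
Mse⊨ {A} s t = (ρ : ℕ → Dom A) → ⟦ s ⟧ ρ ≡ ⟦ t ⟧ ρ

-- Every axiom holds in M_se because the tree operations are all instances of
-- leaf replacement, which is associative in the sense
--   X[T ↦ Y₁, F ↦ Y₂][T ↦ Z₁, F ↦ Z₂] = X[T ↦ Y₁[T ↦ Z₁, F ↦ Z₂], F ↦ Y₂[T ↦ Z₁, F ↦ Z₂]]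
-- and has X[T ↦ T, F ↦ F] = X as unit.  Closure under the rules of equational
-- logic is then an induction on derivations; for substitution one notes that
-- interpreting σ(t) under ρ is interpreting t under the assignment n ↦ ⟦σ n⟧ρ,
-- which lands in the domain because an open term closes up under ρ to a closed
-- term with the same evaluation tree.
module Submission where

open import Defs
open import Data.Nat using (ℕ)
open import Data.Product using (_,_; proj₁; proj₂)
open import Relation.Binary.PropositionalEquality
  using (_≡_; refl; sym; trans; cong; cong₂; module ≡-Reasoning)
open ≡-Reasoning

module _ {A : Set} where

  replace-assoc : (X Y₁ Y₂ Z₁ Z₂ : Tree A) →
    replace (replace X Y₁ Y₂) Z₁ Z₂ ≡ replace X (replace Y₁ Z₁ Z₂) (replace Y₂ Z₁ Z₂)
  replace-assoc T _ _ _ _ = refl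
  replace-assoc F _ _ _ _ = refl
  replace-assoc (node l a r) Y₁ Y₂ Z₁ Z₂ =
    cong₂ (λ l′ r′ → node l′ a r′) (replace-assoc l Y₁ Y₂ Z₁ Z₂) (replace-assoc r Y₁ Y₂ Z₁ Z₂)

  replace-identity : (X : Tree A) → replace X T F ≡ X
  replace-identity T = refl
  replace-identity F = refl
  replace-identity (node l a r) = cong₂ (λ l′ r′ → node l′ a r′) (replace-identity l) (replace-identity r)

  replace-swap-involutive : (X : Tree A) → replace (replace X F T) F T ≡ X
  replace-swap-involutive X = trans (replace-assoc X F T F T) (replace-identity X)

  closedTerm : Term A → (ℕ → Dom A) → Closed A
  closedTerm (var n)  ρ = proj₁ (proj₂ (ρ n))
  closedTerm T        ρ = T
  closedTerm F        ρ = F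
  closedTerm (atom a) ρ = atom a
  closedTerm (¬' t)   ρ = ¬' closedTerm t ρ
  closedTerm (s ∧' t) ρ = closedTerm s ρ ∧' closedTerm t ρ
  closedTerm (s ∨' t) ρ = closedTerm s ρ ∨' closedTerm t ρ

  se-closedTerm : (t : Term A) (ρ : ℕ → Dom A) → se (closedTerm t ρ) ≡ ⟦ t ⟧ ρ
  se-closedTerm (var n)  ρ = proj₂ (proj₂ (ρ n))
  se-closedTerm T        ρ = refl
  se-closedTerm F        ρ = refl
  se-closedTerm (atom a) ρ = refl
  se-closedTerm (¬' t)   ρ = cong (λ X → replace X F T) (se-closedTerm t ρ)
  se-closedTerm (s ∧' t) ρ = cong₂ replaceT (se-closedTerm s ρ) (se-closedTerm t ρ)
  se-closedTerm (s ∨' t) ρ = cong₂ replaceF (se-closedTerm s ρ) (se-closedTerm t ρ)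

  substAssignment : (ℕ → Term A) → (ℕ → Dom A) → ℕ → Dom A
  substAssignment σ ρ n = ⟦ σ n ⟧ ρ , closedTerm (σ n) ρ , se-closedTerm (σ n) ρ

  ⟦subst⟧ : (σ : ℕ → Term A) (t : Term A) (ρ : ℕ → Dom A) →
    ⟦ subst σ t ⟧ ρ ≡ ⟦ t ⟧ (substAssignment σ ρ)
  ⟦subst⟧ σ (var n)  ρ = refl
  ⟦subst⟧ σ T        ρ = refl
  ⟦subst⟧ σ F        ρ = refl
  ⟦subst⟧ σ (atom a) ρ = refl
  ⟦subst⟧ σ (¬' t)   ρ = cong (λ X → replace X F T) (⟦subst⟧ σ t ρ)
  ⟦subst⟧ σ (s ∧' t) ρ = cong₂ replaceT (⟦subst⟧ σ s ρ) (⟦subst⟧ σ t ρ)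
  ⟦subst⟧ σ (s ∨' t) ρ = cong₂ replaceF (⟦subst⟧ σ s ρ) (⟦subst⟧ σ t ρ)

  Mse⊨-axiom : ∀ {s t} → Axiom {A} s t → Mse⊨ s t
  Mse⊨-axiom F1 ρ = refl
  Mse⊨-axiom F2 ρ = sym (begin
      replace (replace (replace X F T) (replace Y F T) F) F T
    ≡⟨ replace-assoc (replace X F T) (replace Y F T) F F T ⟩
      replace (replace X F T) (replace (replace Y F T) F T) T
    ≡⟨ replace-assoc X F T (replace (replace Y F T) F T) T ⟩
      replace X T (replace (replace Y F T) F T)
    ≡⟨ cong (replace X T) (replace-swap-involutive Y) ⟩
      replace X T Y
    ∎)
    where X = proj₁ (ρ 0); Y = proj₁ (ρ 1)
  Mse⊨-axiom F3 ρ = replace-swap-involutive (proj₁ (ρ 0))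
  Mse⊨-axiom F4 ρ = refl
  Mse⊨-axiom F5 ρ = replace-identity (proj₁ (ρ 0))
  Mse⊨-axiom F6 ρ = refl
  Mse⊨-axiom F7 ρ = replace-assoc (proj₁ (ρ 0)) (proj₁ (ρ 1)) F (proj₁ (ρ 2)) F
  Mse⊨-axiom F8 ρ = replace-assoc (proj₁ (ρ 0)) F T F F
  Mse⊨-axiom F9 ρ = trans (replace-assoc X F F T Y) (sym (replace-assoc X T T Y F))
    where X = proj₁ (ρ 0); Y = proj₁ (ρ 1)
  Mse⊨-axiom F10 ρ = begin
      replace (replace X Y F) T Z′
    ≡⟨ replace-assoc X Y F T Z′ ⟩
      replace X (replace Y T Z′) Z′
    ≡⟨ cong (replace X (replace Y T Z′)) (sym (replace-assoc Z F F (replace Y T Z′) F)) ⟩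
      replace X (replace Y T Z′) (replace Z′ (replace Y T Z′) F)
    ≡⟨ sym (replace-assoc X T Z′ (replace Y T Z′) F) ⟩
      replace (replace X T Z′) (replace Y T Z′) F
    ∎
    where X = proj₁ (ρ 0); Y = proj₁ (ρ 1); Z = proj₁ (ρ 2); Z′ = replace Z F F

  Mse⊨-sound : ∀ {s t : Term A} → EqFSCL⊢ s t → Mse⊨ s t
  Mse⊨-sound (ax a)       ρ = Mse⊨-axiom a ρ
  Mse⊨-sound refl'        ρ = refl
  Mse⊨-sound (sym' d)     ρ = sym (Mse⊨-sound d ρ)
  Mse⊨-sound (trans' d e) ρ = trans (Mse⊨-sound d ρ) (Mse⊨-sound e ρ)
  Mse⊨-sound (cong¬ d)    ρ = cong (λ X → replace X F T) (Mse⊨-sound d ρ)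
  Mse⊨-sound (cong∧ d e)  ρ = cong₂ replaceT (Mse⊨-sound d ρ) (Mse⊨-sound e ρ)
  Mse⊨-sound (cong∨ d e)  ρ = cong₂ replaceF (Mse⊨-sound d ρ) (Mse⊨-sound e ρ)
  Mse⊨-sound (inst {s} {t} σ d) ρ = begin
      ⟦ subst σ s ⟧ ρ                    ≡⟨ ⟦subst⟧ σ s ρ ⟩
      ⟦ s ⟧ (substAssignment σ ρ)        ≡⟨ Mse⊨-sound d (substAssignment σ ρ) ⟩
      ⟦ t ⟧ (substAssignment σ ρ)        ≡⟨ sym (⟦subst⟧ σ t ρ) ⟩
      ⟦ subst σ t ⟧ ρ                    ∎

theorem2p4 : (A : Set) → A → (s t : Term A) → EqFSCL⊢ s t → Mse⊨ s t
theorem2p4 A _ s t = Mse⊨-sound
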